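{- For all positive integers $q$ and $n$, $L(q,n)=V_2(q,n)$.
   Context: The $(q,n)$-lattice game is played by builder and coordinator, who build a sequence $p_1,p_2,\dots$ of (not necessarily distinct) points of $\mathbb{Z}_{>0}^q$. In stage 1, coordinator chooses $p_1$. In stage $i+1$ (when $p_1,\dots,p_i$ exist), a number of steps take place: in each step builder selects some point $p_j$ with $j\le i$, and coordinator responds with a coordinate $k\in[q]$, which imposes the constraint that the $k$th coordinate of $p_{i+1}$ is strictly larger than the $k$th coordinate of $p_j$. Builder decides when to end the stage, after which coordinator chooses $p_{i+1}\in\mathbb{Z}^q_{>0}$ satisfying all constraints imposed in that stage. $L(q,n)$ is the minimum total number of steps builder needs to guarantee that some point of the sequence has a coordinate at least $n$. The vertex online Ramsey number $V_2(q,n)$: in stage $t\ge1$ a new vertex $v_t$ is added; for each $i<t$ builder decides (in any order) whether to draw edge $v_iv_t$, and painter must immediately color each drawn edge with one of $q$ colors. $V_2(q,n)$ is the minimum number of edges builder must draw to guarantee vertices $v_{a_1},\dots,v_{a_n}$, $a_1<\dots<a_n$, with all edges $v_{a_i}v_{a_{i+1}}$ drawn and of the same color. -}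

module Defs where

open import Data.Nat using (ℕ; zero; suc; _≤_; _<_)
open import Data.Fin using (Fin)
open import Data.List using (List; []; _∷_; [_]; _++_)
open import Data.List.Membership.Propositional using (_∈_; _∉_)
open import Data.List.Relation.Unary.All using (All)
open import Data.Product using (Σ; ∃; _×_; _,_)
open import Relation.Nullary using (¬_)

-- A point of Z_{>0}^q is a function Fin q → ℕ whose values are all
-- positive (positivity is imposed whenever coordinator chooses a point).
Point : ℕ → Set
Point q = Fin q → ℕ

-- A constraint (r , k) imposed in the current stage: the k-th coordinate
-- of the next point must be strictly larger than the k-th coordinate of r.
Constraint : ℕ → Set
Constraint q = Point q × Fin q

Satisfies : ∀ {q} → Point q → Constraint q → Set
Satisfies p (r , k) = r k < p k

Positive : ∀ {q} → Point q → Set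
Positive p = ∀ k → 0 < p k

-- LWin q n ps cs b : from the position where the points built so far are
-- ps (in order), the constraints imposed so far in the current stage are
-- cs, builder can guarantee (with at most b further steps) that some
-- point of the sequence has a coordinate at least n.
data LWin (q n : ℕ) (ps : List (Point q)) (cs : List (Constraint q)) : ℕ → Set where
  won  : ∀ {b} → (∃ λ p → p ∈ ps × ∃ λ k → n ≤ p k) → LWin q n ps cs b
  -- builder selects an existing point r; coordinator answers with a coordinate k
  step : ∀ {b} (r : Point q) → r ∈ ps →
         (∀ k → LWin q n ps ((r , k) ∷ cs) b) → LWin q n ps cs (suc b)
  -- builder ends the stage; coordinator picks any positive point satisfying
  -- all constraints of this stage
  end  : ∀ {b} → (∀ (p : Point q) → Positive p → All (Satisfies p) cs →
                    LWin q n (ps ++ [ p ]) [] b) → LWin q n ps cs b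

-- Builder can guarantee a win in the (q,n)-lattice game with at most b steps.
-- (Stage 1, where coordinator chooses p₁ freely, is the `end` move from the
-- empty position.)
LatticeWin : ℕ → ℕ → ℕ → Set
LatticeWin q n b = LWin q n [] [] b

-- Vertices v₁, v₂, … are represented by 0, 1, …; t is the number of
-- vertices added so far. A drawn, colored edge v_i v_j (i < j) is (i , j , c).
Edge : ℕ → Set
Edge q = ℕ × ℕ × Fin q

data MonoPath (q t : ℕ) (E : List (Edge q)) (c : Fin q) : ℕ → ℕ → Set where
  one : ∀ {v} → v < t → MonoPath q t E c 1 v
  ext : ∀ {ℓ u v} → MonoPath q t E c ℓ u → u < v → (u , v , c) ∈ E →
        MonoPath q t E c (suc ℓ) v

HasMonoPath : (q t : ℕ) → List (Edge q) → ℕ → Set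
HasMonoPath q t E n = ∃ λ c → ∃ λ v → MonoPath q t E c n v

-- VWin q n t E b : with t vertices present (the newest one, v_t, being the
-- vertex of the current stage) and colored edges E, builder can guarantee
-- a monochromatic increasing path on n vertices drawing at most b more edges.
data VWin (q n : ℕ) : ℕ → List (Edge q) → ℕ → Set where
  won  : ∀ {t E b} → HasMonoPath q t E n → VWin q n t E b
  -- builder draws a not-yet-drawn edge v_i v_s between an earlier vertex i
  -- and the newest vertex s; painter colors it with any color c
  draw : ∀ {s E b} (i : ℕ) → i < s → (∀ c → (i , s , c) ∉ E) →
         (∀ c → VWin q n (suc s) ((i , s , c) ∷ E) b) → VWin q n (suc s) E (suc b)
  next : ∀ {t E b} → VWin q n (suc t) E b → VWin q n t E b

VertexWin : ℕ → ℕ → ℕ → Set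
VertexWin q n b = VWin q n 0 [] b

IsMinimum : (ℕ → Set) → ℕ → Set
IsMinimum P m = P m × (∀ j → j < m → ¬ P j)

module Submission where

-- Both games are compared with a finite "canonical game" in which the
-- opponent answers greedily.  A canonical position consists of the list S
-- of points built so far and a lower bound lb accumulated in the current
-- stage: when builder selects s ∈ S and the opponent answers k, lb is raised
-- at k to s k, and ending the stage appends the least admissible point
-- lb + 1.  Any other answer of the opponent only produces larger points, so
-- builder wins the lattice game with b steps iff he wins the canonical game
-- with b steps.  The same holds for the vertex game, where the point
-- attached to a vertex v lists, for each colour c, the number of vertices of
-- a longest increasing c-coloured path ending at v.

open import Defs
import Data.Nat as ℕ
open import Data.Nat using (ℕ; zero; suc; _+_; _⊔_; _≤_; _<_; z≤n; s≤s; _≤?_; _<?_)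
open import Data.Nat.Properties
  using (≤-refl; ≤-trans; ≤-reflexive; <-≤-trans; ≤-<-trans; <⇒≤; ≮⇒≥; <-irrefl; n≮0;
         m≤m⊔n; m≤n⊔m; ⊔-sel; m≤n⇒m≤1+n; m≤n⇒m<n∨m≡n; ≤-pred; +-suc; +-identityʳ)
open import Data.Fin using (Fin; zero; suc; _≟_)
open import Data.Fin.Properties using (any?; all?; ¬∀⟶∃¬)
open import Data.List using (List; []; _∷_; [_]; _++_; length; upTo; cartesianProductWith)
open import Data.List.Relation.Unary.All as All using (All; _∷_)
open import Data.List.Relation.Unary.Any as Any using (Any; here; there)
open import Data.List.Relation.Unary.Any.Properties using (++⁺ˡ)
open import Data.List.Membership.Propositional using (_∈_; find; lose)
open import Data.List.Membership.Propositional.Properties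
  using (∈-++⁺ˡ; ∈-++⁺ʳ; ∈-++⁻; ∈-upTo⁺; ∈-cartesianProductWith⁺)
open import Data.Product using (∃; _×_; _,_; proj₂)
open import Data.Sum using (_⊎_; inj₁; inj₂)
open import Data.Empty using (⊥-elim)
open import Relation.Nullary using (¬_; Dec; yes; no)
open import Relation.Nullary.Decidable using (map′; _×-dec_; ¬?)
open import Relation.Binary.PropositionalEquality using (_≡_; refl; sym; trans; cong; subst; subst₂)

length-snoc : ∀ {A : Set} (xs : List A) (x : A) → length (xs ++ [ x ]) ≡ suc (length xs)
length-snoc []       x = refl
length-snoc (_ ∷ xs) x = cong suc (length-snoc xs x)

minimum : (P : ℕ → Set) → (∀ j → Dec (P j)) → ∀ b → P b → ∃ (IsMinimum P)
minimum P P? b Pb = scan b 0 (subst P (sym (+-identityʳ b)) Pb) (λ _ ())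
  where
  scan : ∀ d k → P (d + k) → (∀ j → j < k → ¬ P j) → ∃ (IsMinimum P)
  scan d k Pd+k below with P? k
  ... | yes Pk = k , Pk , below
  scan zero    k Pk   below | no ¬Pk = ⊥-elim (¬Pk Pk)
  scan (suc d) k Pd+k below | no ¬Pk = scan d (suc k) (subst P (sym (+-suc d k)) Pd+k) below′
    where
    below′ : ∀ j → j < suc k → ¬ P j
    below′ j (s≤s j≤k) with m≤n⇒m<n∨m≡n j≤k
    ... | inj₁ j<k  = below j j<k
    ... | inj₂ refl = ¬Pk

common-minimum : ∀ {P Q R : ℕ → Set} → (∀ j → Dec (Q j)) → ∃ Q →
                 (∀ {j} → P j → Q j) → (∀ {j} → Q j → P j) →
                 (∀ {j} → R j → Q j) → (∀ {j} → Q j → R j) →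
                 ∃ λ m → IsMinimum P m × IsMinimum R m
common-minimum {Q = Q} Q? (b , Qb) P⇒Q Q⇒P R⇒Q Q⇒R with minimum Q Q? b Qb
... | m , Qm , below =
  m , (Q⇒P Qm , λ j j<m Pj → below j j<m (P⇒Q Pj)) , (Q⇒R Qm , λ j j<m Rj → below j j<m (R⇒Q Rj))

count : ∀ {A : Set} {P : A → Set} → (∀ x → Dec (P x)) → List A → ℕ
count P? []       = 0
count P? (x ∷ xs) with P? x
... | yes _ = suc (count P? xs)
... | no  _ = count P? xs

module _ {A : Set} {P Q : A → Set} (P? : ∀ x → Dec (P x)) (Q? : ∀ x → Dec (Q x))
         (Q⇒P : ∀ x → Q x → P x) where

  count-mono : ∀ xs → count Q? xs ≤ count P? xs
  count-mono []       = z≤n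
  count-mono (x ∷ xs) with P? x | Q? x
  ... | yes _  | yes _  = s≤s (count-mono xs)
  ... | yes _  | no  _  = m≤n⇒m≤1+n (count-mono xs)
  ... | no ¬Px | yes Qx = ⊥-elim (¬Px (Q⇒P x Qx))
  ... | no _   | no _   = count-mono xs

  count-strict : ∀ {y} xs → y ∈ xs → P y → ¬ Q y → count Q? xs < count P? xs
  count-strict (x ∷ xs) (here refl) Px ¬Qx with P? x | Q? x
  ... | yes _  | yes Qx = ⊥-elim (¬Qx Qx)
  ... | yes _  | no _   = s≤s (count-mono xs)
  ... | no ¬Px | _      = ⊥-elim (¬Px Px)
  count-strict (x ∷ xs) (there y∈) Py ¬Qy with P? x | Q? x
  ... | yes _  | yes _  = s≤s (count-strict xs y∈ Py ¬Qy)
  ... | yes _  | no _   = s≤s (<⇒≤ (count-strict xs y∈ Py ¬Qy))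
  ... | no ¬Px | yes Qx = ⊥-elim (¬Px (Q⇒P x Qx))
  ... | no _   | no _   = count-strict xs y∈ Py ¬Qy

_◃_ : ∀ {q} → ℕ → Point q → Point (suc q)
(v ◃ u) zero    = v
(v ◃ u) (suc k) = u k

-- The points of the box [0,n)^q, every one of them listed up to
-- pointwise equality.
box : ℕ → (q : ℕ) → List (Point q)
box n zero    = (λ ()) ∷ []
box n (suc q) = cartesianProductWith _◃_ (upTo n) (box n q)

box-complete : ∀ n q (p : Point q) → (∀ k → p k < n) →
               ∃ λ u → u ∈ box n q × (∀ k → u k ≡ p k)
box-complete n zero    p p<n = (λ ()) , here refl , λ ()
box-complete n (suc q) p p<n with box-complete n q (λ k → p (suc k)) (λ k → p<n (suc k))
... | u , u∈ , u≗p = p zero ◃ u , ∈-cartesianProductWith⁺ _◃_ (∈-upTo⁺ (p<n zero)) u∈ ,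
                     λ { zero → refl ; (suc k) → u≗p k }

path-weaken : ∀ {q t t′ E E′ c m v} → (∀ {e} → e ∈ E → e ∈ E′) → t ≤ t′ →
              MonoPath q t E c m v → MonoPath q t′ E′ c m v
path-weaken E⊆ t≤ (one v<)          = one (<-≤-trans v< t≤)
path-weaken E⊆ t≤ (ext path u<v e∈) = ext (path-weaken E⊆ t≤ path) u<v (E⊆ e∈)

path-truncate : ∀ {q t E c m m′ v} → MonoPath q t E c m v → v < t → m′ ≤ m → 1 ≤ m′ →
                MonoPath q t E c m′ v
path-truncate (one _)            v<t (s≤s z≤n) _ = one v<t
path-truncate {m′ = suc zero}    (ext _ _ _) v<t _ _ = one v<t
path-truncate {m′ = suc (suc _)} (ext path u<v e∈) v<t (s≤s m′≤m) _ =
  ext (path-truncate path (<-≤-trans u<v (<⇒≤ v<t)) m′≤m (s≤s z≤n)) u<v e∈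

vwin-weaken : ∀ {q n t E b} → VWin q n t E b → VWin q n t E (suc b)
vwin-weaken (VWin.won path)          = VWin.won path
vwin-weaken (VWin.draw i i< new win) = VWin.draw i i< new (λ c → vwin-weaken (win c))
vwin-weaken (VWin.next win)          = VWin.next (vwin-weaken win)

drawn? : ∀ {q} i j (E : List (Edge q)) → Dec (∃ λ c → (i , j , c) ∈ E)
drawn? i j E = map′ edge (λ (_ , e∈) → lose e∈ (refl , refl))
                 (Any.any? (λ (a , b , _) → (a ℕ.≟ i) ×-dec (b ℕ.≟ j)) E)
  where
  edge : Any (λ (a , b , _) → a ≡ i × b ≡ j) E → ∃ λ c → (i , j , c) ∈ E
  edge within with find within
  ... | (_ , _ , c) , e∈ , refl , refl = c , e∈

module Canonical (q n : ℕ) where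

  _≤ₚ_ : Point q → Point q → Set
  p ≤ₚ r = ∀ k → p k ≤ r k

  Large : Point q → Set
  Large p = ∃ λ k → n ≤ p k

  origin : Point q
  origin _ = 0

  above : Point q → Point q
  above lb k = suc (lb k)

  above-positive : ∀ lb → Positive (above lb)
  above-positive lb k = s≤s z≤n

  raise : Point q → Fin q → ℕ → Point q
  raise lb k v j with j ≟ k
  ... | yes _ = lb j ⊔ v
  ... | no  _ = lb j

  raise-≥ : ∀ lb k v → lb ≤ₚ raise lb k v
  raise-≥ lb k v j with j ≟ k
  ... | yes _ = m≤m⊔n (lb j) v
  ... | no  _ = ≤-refl

  raise-at : ∀ lb k v → v ≤ raise lb k v k
  raise-at lb k v with k ≟ k
  ... | yes _ = m≤n⊔m (lb k) v
  ... | no k≢k = ⊥-elim (k≢k refl)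

  raise-cases : ∀ lb k v j → raise lb k v j ≡ lb j ⊎ (j ≡ k × raise lb k v j ≡ v)
  raise-cases lb k v j with j ≟ k
  ... | no _ = inj₁ refl
  ... | yes j≡k with ⊔-sel (lb j) v
  ...   | inj₁ eq = inj₁ eq
  ...   | inj₂ eq = inj₂ (j≡k , eq)

  raise-< : ∀ lb k v (p : Point q) → (∀ j → lb j < p j) → v < p k → ∀ j → raise lb k v j < p j
  raise-< lb k v p lb<p v<pk j with raise-cases lb k v j
  ... | inj₁ eq         rewrite eq = lb<p j
  ... | inj₂ (refl , eq) rewrite eq = v<pk

  -- Canon S lb b f: from the canonical position (S, lb), builder wins using
  -- at most b further steps and f further stage ends.  The stage budget f
  -- makes the game finite.
  data Canon : List (Point q) → Point q → ℕ → ℕ → Set where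
    won  : ∀ {S lb b f} → Any Large S → Canon S lb b f
    step : ∀ {S lb b f} → Any (λ s → ∀ k → Canon S (raise lb k (s k)) b f) S →
           Canon S lb (suc b) f
    end  : ∀ {S lb b f} → Canon (S ++ [ above lb ]) origin b f → Canon S lb b (suc f)

  large? : ∀ p → Dec (Large p)
  large? p = any? (λ k → n ≤? p k)

  StepMove : List (Point q) → Point q → ℕ → ℕ → Set
  StepMove S lb b f = ∃ λ b′ → b ≡ suc b′ × Any (λ s → ∀ k → Canon S (raise lb k (s k)) b′ f) S

  EndMove : List (Point q) → Point q → ℕ → ℕ → Set
  EndMove S lb b f = ∃ λ f′ → f ≡ suc f′ × Canon (S ++ [ above lb ]) origin b f′

  canon? : ∀ S lb b f → Dec (Canon S lb b f)
  step? : ∀ S lb b f → Dec (StepMove S lb b f)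
  end? : ∀ S lb b f → Dec (EndMove S lb b f)

  canon? S lb b f with Any.any? large? S | step? S lb b f | end? S lb b f
  ... | yes w | _                  | _                  = yes (won w)
  ... | no _  | yes (_ , refl , a) | _                  = yes (step a)
  ... | no _  | no _               | yes (_ , refl , c) = yes (end c)
  ... | no ¬w | no ¬s              | no ¬e              =
    no λ { (won w) → ¬w w ; (step a) → ¬s (_ , refl , a) ; (end c) → ¬e (_ , refl , c) }

  step? S lb zero     f = no λ { (_ , () , _) }
  step? S lb (suc b′) f with Any.any? (λ s → all? (λ k → canon? S (raise lb k (s k)) b′ f)) S
  ... | yes a = yes (b′ , refl , a)
  ... | no ¬a = no λ { (_ , refl , a) → ¬a a }

  end? S lb b zero     = no λ { (_ , () , _) }
  end? S lb b (suc f′) with canon? (S ++ [ above lb ]) origin b f′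
  ... | yes c = yes (f′ , refl , c)
  ... | no ¬c = no λ { (_ , refl , c) → ¬c c }

  _⊑_ : List (Point q) → List (Point q) → Set
  ps ⊑ S = ∀ {p} → p ∈ ps → ∃ λ s → s ∈ S × p ≤ₚ s

  large-⊑ : ∀ {ps S} → Any Large ps → ps ⊑ S → Any Large S
  large-⊑ large cover with find large
  ... | p , p∈ , k , n≤pk with cover p∈
  ...   | s , s∈ , p≤s = lose s∈ (k , ≤-trans n≤pk (p≤s k))

  ⊑-snoc : ∀ {ps S S′ p} → ps ⊑ S → (∀ {s} → s ∈ S → s ∈ S′) →
           (∃ λ s → s ∈ S′ × p ≤ₚ s) → (ps ++ [ p ]) ⊑ S′
  ⊑-snoc {ps} cover S⊆S′ p≤s p∈ with ∈-++⁻ ps p∈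
  ... | inj₂ (here refl) = p≤s
  ... | inj₁ p∈ps with cover p∈ps
  ...   | s , s∈ , le = s , S⊆S′ s∈ , le

  ⊑-snoc-both : ∀ {ps S} p → ps ⊑ S → (ps ++ [ p ]) ⊑ (S ++ [ p ])
  ⊑-snoc-both {S = S} p cover = ⊑-snoc cover ∈-++⁺ˡ (p , ∈-++⁺ʳ S (here refl) , λ _ → ≤-refl)

  Positives : List (Point q) → Set
  Positives S = ∀ {s} → s ∈ S → Positive s

  positives-snoc : ∀ {S p} → Positives S → Positive p → Positives (S ++ [ p ])
  positives-snoc {S} pos pos-p s∈ with ∈-++⁻ S s∈
  ... | inj₁ s∈S        = pos s∈S
  ... | inj₂ (here refl) = pos-p

  -- The point (1,…,1) is covered by any positive point.
  ⊑-skip : ∀ {ps S s} → ps ⊑ S → Positives S → s ∈ S → (ps ++ [ above origin ]) ⊑ S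
  ⊑-skip cover pos s∈ = ⊑-snoc cover (λ s∈ → s∈) (_ , s∈ , pos s∈)

  -- Stage budget sufficient for b steps: one stage per step plus one, or
  -- one per step when a stage has just begun (lb = origin) after some
  -- point was built; ending that stage at once would add (1,…,1), a point
  -- covered by any earlier one, so such a stage need not be played.
  Fuel : List (Point q) → Point q → ℕ → ℕ → Set
  Fuel S lb b f = suc b ≤ f ⊎ (b ≤ f × (∃ λ s → s ∈ S) × lb ≡ origin)

  fuel-step : ∀ {S lb lb′ b f} → Fuel S lb (suc b) f → Fuel S lb′ b f
  fuel-step (inj₁ b+1<f)       = inj₁ (<⇒≤ b+1<f)
  fuel-step (inj₂ (b+1≤f , _)) = inj₁ b+1≤f

  fuel-fresh : ∀ {S b f} p → b ≤ f → Fuel (S ++ [ p ]) origin b f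
  fuel-fresh {S} p b≤f = inj₂ (b≤f , (p , ∈-++⁺ʳ S (here refl)) , refl)

  -- If the next greedy point is already large, builder wins by ending the
  -- stage (or, at a fresh stage, n ≤ 1 and every built point is large).
  win-by-ending : ∀ {S lb b f} → Fuel S lb b f → Positives S → Large (above lb) → Canon S lb b f
  win-by-ending {S} (inj₁ (s≤s _)) _ large = end (won (lose (∈-++⁺ʳ S (here refl)) large))
  win-by-ending (inj₂ (_ , (s , s∈) , refl)) pos (k , n≤1) = won (lose s∈ (k , ≤-trans n≤1 (pos s∈ k)))

  -- lb records the constraints cs: the point above lb satisfies all of them.
  Records : List (Constraint q) → Point q → Set
  Records cs lb = ∀ {r k} → (r , k) ∈ cs → r k ≤ lb k

  records-step : ∀ {cs lb r s} k → Records cs lb → r ≤ₚ s → Records ((r , k) ∷ cs) (raise lb k (s k))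
  records-step {lb = lb} {s = s} k _ r≤s (here refl) = ≤-trans (r≤s k) (raise-at lb k (s k))
  records-step {lb = lb} {s = s} k rec r≤s {k = j} (there c∈) = ≤-trans (rec c∈) (raise-≥ lb k (s k) j)

  above-satisfies : ∀ {cs lb} → Records cs lb → All (Satisfies (above lb)) cs
  above-satisfies rec = All.tabulate λ { {r , k} c∈ → s≤s (rec c∈) }

  -- Lattice game ⇒ canonical game: let coordinator always choose the least
  -- admissible point.  The lattice points are covered by the canonical ones.
  lattice⇒canon : ∀ {ps cs b} → LWin q n ps cs b → ∀ S lb f →
                  ps ⊑ S → Positives S → Records cs lb → Fuel S lb b f → Canon S lb b f
  lattice⇒canon (LWin.won (_ , p∈ , large)) _ _ _ cover _ _ _ =
    won (large-⊑ (lose p∈ large) cover)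
  lattice⇒canon (LWin.step r r∈ win) S lb f cover pos rec fuel with cover r∈
  ... | s , s∈ , r≤s = step (lose s∈ λ k →
          lattice⇒canon (win k) S (raise lb k (s k)) f cover pos (records-step k rec r≤s) (fuel-step fuel))
  lattice⇒canon (LWin.end win) S lb (suc f) cover pos rec (inj₁ (s≤s b≤f)) =
    end (lattice⇒canon (win (above lb) (above-positive lb) (above-satisfies rec))
          (S ++ [ above lb ]) origin f (⊑-snoc-both (above lb) cover)
          (positives-snoc pos (above-positive lb)) (λ ()) (fuel-fresh (above lb) b≤f))
  lattice⇒canon (LWin.end win) S lb f cover pos rec fuel@(inj₂ (_ , (s , s∈) , refl)) =
    lattice⇒canon (win (above lb) (above-positive lb) (above-satisfies rec))
      S lb f (⊑-skip cover pos s∈) pos (λ ()) fuel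

  Forces : List (Constraint q) → Point q → Set
  Forces cs lb = ∀ (p : Point q) → Positive p → All (Satisfies p) cs → ∀ k → lb k < p k

  forces-step : ∀ {cs lb r s} k → Forces cs lb → s ≤ₚ r → Forces ((r , k) ∷ cs) (raise lb k (s k))
  forces-step {lb = lb} {s = s} k forces s≤r p pos (rk<pk ∷ sat) =
    raise-< lb k (s k) p (forces p pos sat) (≤-<-trans (s≤r k) rk<pk)

  -- Canonical game ⇒ lattice game: against an arbitrary coordinator, builder
  -- plays the canonical strategy on points below the actual ones.
  canon⇒lattice : ∀ {S lb b f} → Canon S lb b f → ∀ ps cs → S ⊑ ps → Forces cs lb → LWin q n ps cs b
  canon⇒lattice (won large) _ _ cover _ = LWin.won (find (large-⊑ large cover))
  canon⇒lattice (step move) ps cs cover forces with find move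
  ... | s , s∈ , win with cover s∈
  ...   | r , r∈ , s≤r = LWin.step r r∈ λ k →
            canon⇒lattice (win k) ps ((r , k) ∷ cs) cover (forces-step k forces s≤r)
  canon⇒lattice (end win) ps cs cover forces = LWin.end λ p pos sat →
    canon⇒lattice win (ps ++ [ p ]) []
      (⊑-snoc cover ∈-++⁺ˡ (p , ∈-++⁺ʳ ps (here refl) , forces p pos sat)) (λ p pos _ → pos)

  -- label L cur v: the point attached to vertex v, where L lists the points
  -- of the earlier vertices 0, …, length L - 1 and cur is the point of the
  -- current vertex length L.
  label : List (Point q) → Point q → ℕ → Point q
  label []      cur v       = cur
  label (p ∷ L) cur zero    = p
  label (p ∷ L) cur (suc v) = label L cur v

  label-current : ∀ L cur → label L cur (length L) ≡ cur
  label-current []      cur = refl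
  label-current (p ∷ L) cur = label-current L cur

  label-old : ∀ L cur cur′ v → v < length L → label L cur v ≡ label L cur′ v
  label-old (p ∷ L) cur cur′ zero    _       = refl
  label-old (p ∷ L) cur cur′ (suc v) (s≤s v<) = label-old L cur cur′ v v<

  label-snoc : ∀ L p cur v → v ≤ length L → label (L ++ [ p ]) cur v ≡ label L p v
  label-snoc []      p cur zero    _       = refl
  label-snoc (_ ∷ L) p cur zero    _       = refl
  label-snoc (_ ∷ L) p cur (suc v) (s≤s v≤) = label-snoc L p cur v v≤

  label-∈ : ∀ L cur v → v < length L → label L cur v ∈ L
  label-∈ (p ∷ L) cur zero    _       = here refl
  label-∈ (p ∷ L) cur (suc v) (s≤s v<) = there (label-∈ L cur v v<)

  label-cases : ∀ L cur v → label L cur v ∈ L ⊎ label L cur v ≡ cur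
  label-cases []      cur v       = inj₂ refl
  label-cases (p ∷ L) cur zero    = inj₁ (here refl)
  label-cases (p ∷ L) cur (suc v) with label-cases L cur v
  ... | inj₁ ∈L  = inj₁ (there ∈L)
  ... | inj₂ ≡cur = inj₂ ≡cur

  label-index : ∀ L cur {p} → p ∈ L → ∃ λ v → v < length L × label L cur v ≡ p
  label-index (p ∷ L) cur (here refl) = zero , s≤s z≤n , refl
  label-index (_ ∷ L) cur (there p∈) with label-index L cur p∈
  ... | v , v< , eq = suc v , s≤s v< , eq

  label-mono : ∀ L {cur cur′} → cur ≤ₚ cur′ → ∀ v → label L cur v ≤ₚ label L cur′ v
  label-mono []      cur≤ v       = cur≤
  label-mono (p ∷ L) cur≤ zero    = λ _ → ≤-refl
  label-mono (p ∷ L) cur≤ (suc v) = label-mono L cur≤ v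

  label-positive : ∀ {L} → Positives L → ∀ lb v → Positive (label L (above lb) v)
  label-positive {L} pos lb v with label-cases L (above lb) v
  ... | inj₁ ∈L  = pos ∈L
  ... | inj₂ eq rewrite eq = above-positive lb

  path≤label : ∀ {t E c m v} (lab : ℕ → Point q) → (∀ w → Positive (lab w)) →
               (∀ {u w c} → (u , w , c) ∈ E → lab u c < lab w c) →
               MonoPath q t E c m v → m ≤ lab v c
  path≤label {c = c} {v = v} lab pos incr (one _) = pos v c
  path≤label lab pos incr (ext path _ e∈) = ≤-<-trans (path≤label lab pos incr path) (incr e∈)

  Increasing : List (Point q) → Point q → List (Edge q) → Set
  Increasing L lb E = ∀ {u v c} → (u , v , c) ∈ E →
    u < length L × v ≤ length L × label L (above lb) u c < label L (above lb) v c

  increasing-draw : ∀ {L lb E i σ} k → Increasing L lb E → i < length L →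
                    label L (above lb) i ≤ₚ σ → Increasing L (raise lb k (σ k)) ((i , length L , k) ∷ E)
  increasing-draw {L} {lb} {i = i} {σ} k _ i< lab≤σ (here refl) =
    i< , ≤-refl ,
    subst₂ (λ a b → a k < b k)
      (label-old L (above lb) (above lb′) i i<) (sym (label-current L (above lb′)))
      (s≤s (≤-trans (lab≤σ k) (raise-at lb k (σ k))))
    where lb′ = raise lb k (σ k)
  increasing-draw {L} {lb} {σ = σ} k incr i< lab≤σ {u} {v} {c} (there e∈) with incr e∈
  ... | u< , v≤ , lab< =
    u< , v≤ ,
    subst (λ a → a c < label L (above lb′) v c) (label-old L (above lb) (above lb′) u u<)
      (<-≤-trans lab< (label-mono L (λ j → s≤s (raise-≥ lb k (σ k) j)) v c))
    where lb′ = raise lb k (σ k)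

  increasing-next : ∀ {L lb E} → Increasing L lb E → Increasing (L ++ [ above lb ]) origin E
  increasing-next {L} {lb} incr {u} {v} e∈ with incr e∈
  ... | u< , v≤ , lab<
    rewrite label-snoc L (above lb) (above origin) u (<⇒≤ u<)
          | label-snoc L (above lb) (above origin) v v≤
          | length-snoc L (above lb) = m≤n⇒m≤1+n u< , m≤n⇒m≤1+n v≤ , lab<

  large-label⇒canon : ∀ {L S lb b f} v → L ⊑ S → Positives S → Fuel S lb b f →
                      Large (label L (above lb) v) → Canon S lb b f
  large-label⇒canon {L} {lb = lb} v cover pos fuel large with label-cases L (above lb) v
  ... | inj₁ ∈L  = won (large-⊑ (lose ∈L large) cover)
  ... | inj₂ eq = win-by-ending fuel pos (subst Large eq large)

  -- Vertex game ⇒ canonical game: painter colours each edge v_i v_t with the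
  -- coordinate the canonical coordinator answers for the point of v_i.
  vertex⇒canon : ∀ {t E b} → VWin q n t E b → ∀ L S lb f → t ≡ suc (length L) →
                 L ⊑ S → Positives S → Positives L → Increasing L lb E → Fuel S lb b f → Canon S lb b f
  vertex⇒canon (VWin.won (c , v , path)) L _ lb _ _ cover posS posL incr fuel =
    large-label⇒canon v cover posS fuel
      (c , path≤label (label L (above lb)) (label-positive posL lb) (λ e∈ → proj₂ (proj₂ (incr e∈))) path)
  vertex⇒canon (VWin.draw i i< _ win) L S lb f refl cover posS posL incr fuel
    with cover (label-∈ L (above lb) i i<)
  ... | σ , σ∈ , lab≤σ = step (lose σ∈ λ k →
          vertex⇒canon (win k) L S (raise lb k (σ k)) f refl cover posS posL
            (increasing-draw {L} k incr i< lab≤σ) (fuel-step fuel))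
  vertex⇒canon (VWin.next win) L S lb (suc f) refl cover posS posL incr (inj₁ (s≤s b≤f)) =
    end (vertex⇒canon win (L ++ [ above lb ]) (S ++ [ above lb ]) origin f
          (cong suc (sym (length-snoc L _)))
          (⊑-snoc-both (above lb) cover) (positives-snoc posS (above-positive lb))
          (positives-snoc posL (above-positive lb)) (increasing-next {L} incr)
          (fuel-fresh (above lb) b≤f))
  vertex⇒canon (VWin.next win) L S lb f refl cover posS posL incr fuel@(inj₂ (_ , (s , s∈) , refl)) =
    vertex⇒canon win (L ++ [ above lb ]) S lb f (cong suc (sym (length-snoc L _)))
      (⊑-skip cover posS s∈) posS (positives-snoc posL (above-positive lb)) (increasing-next {L} incr) fuel

  Realised : List (Point q) → Point q → ℕ → List (Edge q) → Set
  Realised S lb t E = ∀ v c → v ≤ length S → MonoPath q t E c (label S (above lb) v c) v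

  -- After the edge v_i v_current of colour k appears, the current point may be
  -- raised at k to the label of v_i: extend the k-coloured path ending at v_i.
  realised-draw : ∀ {S lb t E E′ i} k → (∀ {e} → e ∈ E → e ∈ E′) → (i , length S , k) ∈ E′ →
                  i < length S → Realised S lb t E →
                  Realised S (raise lb k (label S (above lb) i k)) t E′
  realised-draw {S} {lb} {t} {E′ = E′} {i} k E⊆ e∈ i< paths v c v≤ with m≤n⇒m<n∨m≡n v≤
  ... | inj₁ v<
    rewrite label-old S (above (raise lb k (label S (above lb) i k))) (above lb) v v< =
      path-weaken E⊆ ≤-refl (paths v c v≤)
  ... | inj₂ refl
    rewrite label-current S (above (raise lb k (label S (above lb) i k)))
    with raise-cases lb k (label S (above lb) i k) c
  ...   | inj₁ eq rewrite eq =
      subst (λ p → MonoPath q t E′ c (p c) (length S)) (label-current S (above lb))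
        (path-weaken E⊆ ≤-refl (paths (length S) c ≤-refl))
  ...   | inj₂ (refl , eq) rewrite eq = ext (path-weaken E⊆ ≤-refl (paths i k (<⇒≤ i<))) i< e∈

  realised-next : ∀ {S lb t E} → t ≡ suc (length S) → Realised S lb t E →
                  Realised (S ++ [ above lb ]) origin (suc t) E
  realised-next {S} {lb} {t} {E} refl paths v c v≤
    with m≤n⇒m<n∨m≡n (subst (v ≤_) (length-snoc S (above lb)) v≤)
  ... | inj₁ (s≤s v≤S) rewrite label-snoc S (above lb) (above origin) v v≤S =
      path-weaken (λ e∈ → e∈) (m≤n⇒m≤1+n ≤-refl) (paths v c v≤S)
  ... | inj₂ refl =
      subst (λ p → MonoPath q (suc t) E c (p c) (suc (length S))) (sym current) (one ≤-refl)
    where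
    current : label (S ++ [ above lb ]) (above origin) (suc (length S)) ≡ above origin
    current = subst (λ ℓ → label (S ++ [ above lb ]) (above origin) ℓ ≡ above origin)
                (length-snoc S (above lb)) (label-current (S ++ [ above lb ]) (above origin))

  -- Canonical game ⇒ vertex game: against an arbitrary painter, the points
  -- of the canonical game are the vertex labels; selecting the point of v_i
  -- means drawing v_i v_current (if already drawn, its colour is the answer).
  canon⇒vertex : 1 ≤ n → ∀ {S lb b f} → Canon S lb b f → ∀ t E → t ≡ suc (length S) →
                 Realised S lb t E → VWin q n t E b
  canon⇒vertex 1≤n {S} {lb} (won large) t E refl paths with find large
  ... | s , s∈ , k , n≤sk with label-index S (above lb) s∈
  ...   | v , v< , refl = VWin.won (k , v , path-truncate (paths v k (<⇒≤ v<)) (m≤n⇒m≤1+n v<) n≤sk 1≤n)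
  canon⇒vertex 1≤n {S} {lb} (step move) t E refl paths with find move
  ... | s , s∈ , win with label-index S (above lb) s∈
  ...   | i , i< , refl with drawn? i (length S) E
  ...     | yes (c , e∈) =
              vwin-weaken (canon⇒vertex 1≤n (win c) t E refl (realised-draw {S} c (λ e∈ → e∈) e∈ i< paths))
  ...     | no ¬drawn = VWin.draw i i< (λ c e∈ → ¬drawn (c , e∈)) λ c →
              canon⇒vertex 1≤n (win c) t _ refl (realised-draw {S} c there (here refl) i< paths)
  canon⇒vertex 1≤n {S} {lb} (end win) t E t≡ paths =
    VWin.next (canon⇒vertex 1≤n win (suc t) E (cong suc (trans t≡ (sym (length-snoc S (above lb)))))
                (realised-next {S} t≡ paths))

  Dominated : List (Point q) → Point q → Set
  Dominated S u = Any (u ≤ₚ_) S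

  dominated? : ∀ S u → Dec (Dominated S u)
  dominated? S u = Any.any? (λ s → all? (λ k → u k ≤? s k)) S

  undominated : List (Point q) → ℕ
  undominated S = count (λ u → ¬? (dominated? S u)) (box n q)

  -- lb has caught up with every point of S in some coordinate, so that no
  -- point of S dominates above lb.
  Escapes : List (Point q) → Point q → Set
  Escapes S lb = ∀ {s} → s ∈ S → ∃ λ k → s k ≤ lb k

  undominated-snoc : ∀ S lb → (∀ k → above lb k < n) → Escapes S lb →
                     undominated (S ++ [ above lb ]) < undominated S
  undominated-snoc S lb in-box escapes with box-complete n q (above lb) in-box
  ... | u , u∈ , u≗p =
    count-strict (λ u → ¬? (dominated? S u)) (λ u → ¬? (dominated? (S ++ [ above lb ]) u))
      (λ _ ¬dom dom → ¬dom (++⁺ˡ dom)) (box n q) u∈ ¬dominated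
      (λ ¬dom → ¬dom (lose (∈-++⁺ʳ S (here refl)) (λ k → ≤-reflexive (u≗p k))))
    where
    ¬dominated : ¬ Dominated S u
    ¬dominated dom with find dom
    ... | s , s∈ , u≤s with escapes s∈
    ...   | k , sk≤lbk = <-irrefl refl (≤-trans (s≤s sk≤lbk) (subst (_≤ s k) (u≗p k) (u≤s k)))

  select-all : ∀ {S B f} → (∀ lb → Escapes S lb → Canon S lb B f) →
               ∀ R → (∀ {r} → r ∈ R → r ∈ S) → ∀ lb → (∀ {s} → s ∈ S → s ∈ R ⊎ ∃ λ k → s k ≤ lb k) →
               Canon S lb (length R + B) f
  select-all continue [] R⊆S lb pending = continue lb escapes
    where
    escapes : Escapes _ lb
    escapes s∈ with pending s∈
    ... | inj₂ caught = caught
  select-all continue (r ∷ R) R⊆S lb pending =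
    step (lose (R⊆S (here refl)) λ k →
      select-all continue R (λ r∈ → R⊆S (there r∈)) (raise lb k (r k)) (pending′ k))
    where
    pending′ : ∀ k {s} → s ∈ _ → s ∈ R ⊎ ∃ λ j → s j ≤ raise lb k (r k) j
    pending′ k s∈ with pending s∈
    ... | inj₁ (here refl)      = inj₂ (k , raise-at lb k (r k))
    ... | inj₁ (there s∈R)      = inj₁ s∈R
    ... | inj₂ (j , sj≤lbj)     = inj₂ (j , ≤-trans sj≤lbj (raise-≥ lb k (r k) j))

  -- Steps used by the strategy below with s points built and at most m + 1
  -- stages left: every stage selects each existing point once, so
  -- budget m s = s + (s + 1) + … + (s + m).
  budget : ℕ → ℕ → ℕ
  budget-after : ℕ → ℕ → ℕ
  budget m s = s + budget-after m s
  budget-after zero    s = 0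
  budget-after (suc m) s = budget m (suc s)

  -- The strategy: in each stage select every built point once, then end the
  -- stage.  The new point escapes all earlier ones, so either it leaves the
  -- box (builder has won) or the potential drops; hence the potential bounds
  -- the number of stages.
  strategy : ∀ m S → undominated S ≤ m → Canon S origin (budget m (length S)) (suc m)
  strategy-after : ∀ m S → undominated S ≤ m → ∀ lb → Escapes S lb →
                   Canon S lb (budget-after m (length S)) (suc m)
  strategy m S ≤m = select-all (strategy-after m S ≤m) S (λ s∈ → s∈) origin inj₁
  strategy-after m S ≤m lb escapes with all? (λ k → above lb k <? n)
  ... | no ¬in-box with ¬∀⟶∃¬ q (λ k → above lb k < n) (λ k → above lb k <? n) ¬in-box
  ...   | k , ¬<n = end (won (lose (∈-++⁺ʳ S (here refl)) (k , ≮⇒≥ ¬<n)))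
  strategy-after zero S ≤0 lb escapes | yes in-box =
    ⊥-elim (n≮0 (<-≤-trans (undominated-snoc S lb in-box escapes) ≤0))
  strategy-after (suc m) S ≤m+1 lb escapes | yes in-box =
    end (subst (λ s → Canon (S ++ [ above lb ]) origin (budget m s) (suc m)) (length-snoc S (above lb))
          (strategy m (S ++ [ above lb ]) (≤-pred (<-≤-trans (undominated-snoc S lb in-box escapes) ≤m+1))))

  CanonWin : ℕ → Set
  CanonWin j = Canon [] origin j (suc j)

  canonWin? : ∀ j → Dec (CanonWin j)
  canonWin? j = canon? [] origin j (suc j)

  lattice⇒canonWin : ∀ {j} → LatticeWin q n j → CanonWin j
  lattice⇒canonWin win = lattice⇒canon win [] origin _ (λ ()) (λ ()) (λ ()) (inj₁ ≤-refl)

  canon⇒latticeWin : ∀ {j f} → Canon [] origin j f → LatticeWin q n j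
  canon⇒latticeWin win = canon⇒lattice win [] [] (λ ()) (λ p pos _ → pos)

  -- At the start of the vertex game builder can only add the first vertex.
  vertexWin⇒canonWin : ∀ {j} → VertexWin q n j → CanonWin j
  vertexWin⇒canonWin (VWin.won (_ , _ , one ()))
  vertexWin⇒canonWin (VWin.won (_ , _ , ext _ _ ()))
  vertexWin⇒canonWin (VWin.next win) =
    vertex⇒canon win [] [] origin _ refl (λ ()) (λ ()) (λ ()) (λ ()) (inj₁ ≤-refl)

  canonWin⇒vertexWin : 1 ≤ n → ∀ {j} → CanonWin j → VertexWin q n j
  canonWin⇒vertexWin 1≤n win = VWin.next (canon⇒vertex 1≤n win 1 [] refl one-vertex)
    where
    one-vertex : Realised [] origin 1 []
    one-vertex zero c _ = one ≤-refl

  -- Some budget wins; the detour through the lattice game adjusts the stage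
  -- budget to CanonWin's.
  canonWin-exists : ∃ CanonWin
  canonWin-exists = _ , lattice⇒canonWin (canon⇒latticeWin (strategy (undominated []) [] ≤-refl))

lemma2 : ∀ (q n : ℕ) → 1 ≤ q → 1 ≤ n →
    ∃ λ m → IsMinimum (LatticeWin q n) m × IsMinimum (VertexWin q n) m
lemma2 q n _ 1≤n =
  common-minimum canonWin? canonWin-exists
    lattice⇒canonWin canon⇒latticeWin vertexWin⇒canonWin (canonWin⇒vertexWin 1≤n)
  where open Canonical q n
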